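{- Let $C$ be a dendritic face complex with greatest element $\omega$, $n=\dim\omega$. For every $0\le k\le n-1$, $\Lambda_k\subseteq\delta(\gamma^{(k+1)}\omega)$.
   Context: A positive-to-one poset (POP) is a finite set $P$ with $\dim:P\to\mathbb{N}$ and binary relations $\prec^-,\prec^+$; $y\prec x$ means $y\prec^-x$ or $y\prec^+x$. Axioms: $y\prec x\Rightarrow\dim x=\dim y+1$; never both $y\prec^-x$ and $y\prec^+x$; every $x$ with $\dim x\ge1$ has exactly one $y$ with $y\prec^+x$, denoted $\gamma(x)$, and at least one $y$ with $y\prec^-x$. $\delta(x)=\{y:y\prec^-x\}$, $C_k=\dim^{ -1}(k)$; $\le$ is the reflexive-transitive closure of $\prec$. A dendritic face complex is a POP such that: it has a greatest element for $\le$; (oriented thinness) whenever $z\prec^{\beta}y\prec^{\alpha}x$ there is a unique $y'\ne y$ with $z\prec y'\prec x$, and writing $z\prec^{\beta'}y'\prec^{\alpha'}x$ the signs (as $\pm1$) satisfy $\alpha\beta=-\alpha'\beta'$; (acyclicity) $\delta(x)$ is a singleton if $\dim x=1$, nonempty if $\dim x\ge1$, and for $\dim x\ge1$ there are no $p\ge1$, $y_1,\dots,y_p\in\delta(x)$ with $\gamma(y_{i+1})\in\delta(y_i)$ ($1\le i<p$) and $\gamma(y_1)\in\delta(y_p)$. For $0\le k\le n$, $\gamma^{(k)}\omega:=\gamma^{n-k}(\omega)$; $\Lambda_k:=C_k\setminus\{\gamma(c):c\in C_{k+1}\}$. -}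

module Defs where

open import Data.Nat using (ℕ; zero; suc; _≤_; _∸_; s≤s; z≤n)
open import Data.Nat.Properties using (m∸n≤m)
open import Data.Fin using (Fin; inject₁; fromℕ)
import Data.Fin as F
open import Data.Sign using (Sign; opposite) renaming (_*_ to _·_)
import Data.Sign as S
open import Data.Product using (Σ; ∃; ∃-syntax; _×_; _,_; proj₁; proj₂)
open import Data.Sum using (_⊎_)
open import Relation.Nullary using (¬_)
open import Relation.Binary.PropositionalEquality using (_≡_; _≢_; subst)
open import Relation.Binary.Construct.Closure.ReflexiveTransitive using (Star)

-- A positive-to-one poset on the finite carrier Fin N.
-- rel s y x  means  y ≺^s x  (s = S.- or S.+).
record POP (N : ℕ) : Set₁ where
  field
    dim : Fin N → ℕ
    rel : Sign → Fin N → Fin N → Set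
    rel-dim : ∀ s y x → rel s y x → dim x ≡ suc (dim y)
    rel-excl : ∀ y x → ¬ (rel S.- y x × rel S.+ y x)
    plus-unique : ∀ x → 1 ≤ dim x →
      Σ (Fin N) λ y → rel S.+ y x × (∀ y' → rel S.+ y' x → y' ≡ y)
    minus-nonempty : ∀ x → 1 ≤ dim x → ∃[ y ] rel S.- y x

  _≺_ : Fin N → Fin N → Set
  y ≺ x = rel S.- y x ⊎ rel S.+ y x

  _≼_ : Fin N → Fin N → Set
  _≼_ = Star _≺_

  γ : (x : Fin N) → 1 ≤ dim x → Fin N
  γ x p = proj₁ (plus-unique x p)

  γ-dim : ∀ x (p : 1 ≤ dim x) → dim x ≡ suc (dim (γ x p))
  γ-dim x p = rel-dim S.+ (γ x p) x (proj₁ (proj₂ (plus-unique x p)))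

  γ^ : (j : ℕ) (x : Fin N) → j ≤ dim x → Fin N
  γ^ zero x _ = x
  γ^ (suc j) x p = γ^ j (γ x (one≤ p)) (lower p (γ-dim x (one≤ p)))
    where
    one≤ : ∀ {j d} → suc j ≤ d → 1 ≤ d
    one≤ (s≤s _) = s≤s z≤n
    lower : ∀ {j d e} → suc j ≤ d → d ≡ suc e → j ≤ e
    lower (s≤s q) _≡_.refl = q

  γ⁽_⁾ : ℕ → Fin N → Fin N
  γ⁽ k ⁾ x = γ^ (dim x ∸ k) x (m∸n≤m (dim x) k)

  δ : Fin N → Fin N → Set
  δ x y = rel S.- y x

  C : ℕ → Fin N → Set
  C k y = dim y ≡ k

  Λ : ℕ → Fin N → Set
  Λ k y = C k y × (∀ c (p : 1 ≤ dim c) → C (suc k) c → y ≢ γ c p)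

record IsDendritic {N : ℕ} (P : POP N) : Set where
  open POP P
  field
    ω : Fin N
    ω-greatest : ∀ x → x ≼ ω
    thin : ∀ α β x y z → rel β z y → rel α y x →
      Σ (Fin N) λ y' → y' ≢ y × z ≺ y' × y' ≺ x
        × (∀ y'' → y'' ≢ y → z ≺ y'' → y'' ≺ x → y'' ≡ y')
        × (∀ α' β' → rel β' z y' → rel α' y' x → α · β ≡ opposite (α' · β'))
    δ-singleton : ∀ x → dim x ≡ 1 → Σ (Fin N) λ y → δ x y × (∀ y' → δ x y' → y' ≡ y)
    -- (nonemptiness of δ(x) for dim x ≥ 1 is the POP field minus-nonempty)
    -- no cycles y₀,…,y_p (p+1 ≥ 1 elements) in δ(x) with γ(y_{i+1}) ∈ δ(y_i)
    -- and γ(y₀) ∈ δ(y_p); "γ(y) ∈ δ(y')" is written ∃ w. w ≺⁺ y × w ≺⁻ y'.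
    acyclic : ∀ x → 1 ≤ dim x → ∀ (p : ℕ) (ys : Fin (suc p) → Fin N) →
      (∀ i → δ x (ys i)) →
      (∀ (i : Fin p) → ∃[ w ] (rel S.+ w (ys (F.suc i)) × rel S.- w (ys (inject₁ i)))) →
      ¬ (∃[ w ] (rel S.+ w (ys F.zero) × rel S.- w (ys (fromℕ p))))

{-# OPTIONS --safe #-}
module Submission where

-- Since nothing of dimension k + 1 has y as its output, y ≤ z forces y ≤ γ(z) whenever
-- dim z ≥ k + 2.  When dim z = k + 2 this is one application of oriented thinness to
-- y ≺⁻ x ≺⁻ z.  Above that, induction gives y ≤ γ(x) for the inputs x ≤ z above y, and
-- thinness applied to γ(x) ≺⁺ x ≺⁻ z either shows y ≤ γ(z) or gives another input x'
-- above y with γ(x) ∈ δ(x'); since δ(z) is finite and acyclic, the second case cannot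
-- recur forever.  Iterating down from the greatest element ω gives y ≤ γ⁽ᵏ⁺¹⁾(ω), and as
-- the dimensions differ by one, y ∈ δ(γ⁽ᵏ⁺¹⁾(ω)).

open import Defs
open import Data.Nat using (ℕ; zero; suc; _+_; _∸_; _≤_; _<_; s≤s; z≤n)
open import Data.Nat.Properties
  using (≤-refl; ≤-trans; ≤-reflexive; <-≤-trans; <-irrefl; n≤1+n; n<1+n; m≤n+m;
         suc-injective; +-cancelˡ-≡; m∸n≤m; m∸n+n≡m; m∸[m∸n]≡n; +-∸-assoc)
open import Data.Fin using (Fin; toℕ; inject₁; fromℕ)
import Data.Fin as F
open import Data.Fin.Properties using (pigeonhole; toℕ<n; toℕ≤pred[n]; toℕ-inject₁; toℕ-fromℕ)
open import Data.Sign using (opposite) renaming (_*_ to _·_)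
import Data.Sign as S
open import Data.Product using (Σ; ∃-syntax; _×_; _,_; proj₁; proj₂)
open import Data.Empty using (⊥)
open import Data.Sum using (_⊎_; inj₁; inj₂)
open import Relation.Nullary using (¬_; contradiction)
open import Relation.Binary.PropositionalEquality
  using (_≡_; refl; sym; trans; cong; subst; subst₂)
open import Relation.Binary.Construct.Closure.ReflexiveTransitive using (ε; _◅_; _◅◅_)

module POPProperties {N : ℕ} (P : POP N) where
  open POP P

  ≺-sign : ∀ {y x} → y ≺ x → ∃[ s ] rel s y x
  ≺-sign (inj₁ r) = S.- , r
  ≺-sign (inj₂ r) = S.+ , r

  ≺-dim : ∀ {y x} → y ≺ x → dim x ≡ suc (dim y)
  ≺-dim y≺x = rel-dim _ _ _ (proj₂ (≺-sign y≺x))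

  ≼-dim : ∀ {y x} → y ≼ x → dim y ≤ dim x
  ≼-dim ε = ≤-refl
  ≼-dim (y≺y' ◅ y'≼x) = ≤-trans (≤-trans (n≤1+n _) (≤-reflexive (sym (≺-dim y≺y')))) (≼-dim y'≼x)

  ≼-equidim⇒≡ : ∀ {y x} → y ≼ x → dim y ≡ dim x → y ≡ x
  ≼-equidim⇒≡ ε _ = refl
  ≼-equidim⇒≡ (y≺y' ◅ y'≼x) e =
    contradiction (≤-trans (≤-reflexive (sym (≺-dim y≺y'))) (≼-dim y'≼x)) (<-irrefl e)

  ≼-unsnoc : ∀ {y x} → y ≼ x → y ≡ x ⊎ ∃[ x' ] (y ≼ x' × x' ≺ x)
  ≼-unsnoc ε = inj₁ refl
  ≼-unsnoc (y≺y' ◅ y'≼x) with ≼-unsnoc y'≼x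
  ... | inj₁ refl = inj₂ (_ , ε , y≺y')
  ... | inj₂ (x' , y'≼x' , x'≺x) = inj₂ (x' , y≺y' ◅ y'≼x' , x'≺x)

  ≼-penultimate : ∀ {y x} → y ≼ x → dim y < dim x → ∃[ x' ] (y ≼ x' × x' ≺ x)
  ≼-penultimate y≼x lt with ≼-unsnoc y≼x
  ... | inj₁ refl = contradiction lt (<-irrefl refl)
  ... | inj₂ below = below

  ≼-covering⇒≺ : ∀ {y x} → y ≼ x → dim x ≡ suc (dim y) → y ≺ x
  ≼-covering⇒≺ y≼x e with ≼-penultimate y≼x (≤-reflexive (sym e))
  ... | x' , y≼x' , x'≺x = subst (_≺ _) (sym (≼-equidim⇒≡ y≼x' dim-y≡dim-x')) x'≺x
    where
    dim-y≡dim-x' = sym (suc-injective (trans (sym (≺-dim x'≺x)) e))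

  δ-dim : ∀ {x z m} → δ z x → dim z ≡ suc m → dim x ≡ m
  δ-dim x∈δz e = suc-injective (trans (sym (rel-dim _ _ _ x∈δz)) e)

  _▹_ : ∀ {y x w} → y ≼ x → x ≺ w → y ≼ w
  y≼x ▹ x≺w = y≼x ◅◅ (x≺w ◅ ε)

  γ-unique : ∀ {y x} → rel S.+ y x → (q : 1 ≤ dim x) → y ≡ γ x q
  γ-unique {y} {x} r q = proj₂ (proj₂ (plus-unique x q)) y r

  γ^-dim : ∀ j x (p : j ≤ dim x) → j + dim (γ^ j x p) ≡ dim x
  γ^-dim zero x p = refl
  γ^-dim (suc j) x p = trans (cong suc (γ^-dim j _ _)) (sym (γ-dim x _))

  γ⁽⁾-dim : ∀ {k x} → k ≤ dim x → dim (γ⁽ k ⁾ x) ≡ k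
  γ⁽⁾-dim {k} {x} k≤dim = +-cancelˡ-≡ (dim x ∸ k) _ _
    (trans (γ^-dim (dim x ∸ k) x _) (sym (m∸n+n≡m k≤dim)))

  -- y ≤ γ(x), phrased without the proof of 1 ≤ dim x that γ needs
  _≼γ_ : Fin N → Fin N → Set
  y ≼γ x = ∃[ w ] (rel S.+ w x × y ≼ w)

  ≼γ⇒≼-γ : ∀ {y x} → y ≼γ x → (q : 1 ≤ dim x) → y ≼ γ x q
  ≼γ⇒≼-γ (w , w≺⁺x , y≼w) q = subst (_ ≼_) (γ-unique w≺⁺x q) y≼w

  module _ {k y} (y∈Λ : Λ k y) where

    Λ-¬≺⁺ : ∀ {x} → ¬ rel S.+ y x
    Λ-¬≺⁺ {x} r = proj₂ y∈Λ x q dim-x (γ-unique r q)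
      where
      dim-x : dim x ≡ suc k
      dim-x = trans (rel-dim _ _ _ r) (cong suc (proj₁ y∈Λ))
      q : 1 ≤ dim x
      q = subst (1 ≤_) (sym dim-x) (s≤s z≤n)

    Λ-≺⇒δ : ∀ {x} → y ≺ x → δ x y
    Λ-≺⇒δ (inj₁ r) = r
    Λ-≺⇒δ (inj₂ r) = contradiction r Λ-¬≺⁺

module DendriticProperties {N : ℕ} {P : POP N} (D : IsDendritic P) where
  open POP P
  open IsDendritic D
  open POPProperties P

  thin-signs : ∀ {α β x y z} → rel β z y → rel α y x →
    ∃[ y' ] ∃[ α' ] ∃[ β' ] (rel β' z y' × rel α' y' x × α · β ≡ opposite (α' · β'))
  thin-signs {α} {β} {x} {y} {z} z≺y y≺x with thin α β x y z z≺y y≺x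
  ... | y' , _ , z≺y' , y'≺x , _ , signs with ≺-sign z≺y' | ≺-sign y'≺x
  ... | β' , r | α' , r' = y' , α' , β' , r , r' , signs α' β' r r'

  -- x ⇝ x' says γ(x) ∈ δ(x'), the edge relation of the acyclicity axiom
  _⇝_ : Fin N → Fin N → Set
  x ⇝ x' = ∃[ w ] (rel S.+ w x × rel S.- w x')

  record Walk (z : Fin N) (t : ℕ) : Set where
    field
      vertex : ℕ → Fin N
      inside : ∀ i → i ≤ t → δ z (vertex i)
      step : ∀ i → i < t → vertex i ⇝ vertex (suc i)

  open Walk

  cons : ∀ {z t x} → δ z x → (w : Walk z t) → x ⇝ vertex w 0 → Walk z (suc t)
  cons {x = x} x∈δz w x⇝w₀ = record { vertex = vertex′ ; inside = inside′ ; step = step′ }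
    where
    vertex′ : ℕ → Fin N
    vertex′ zero = x
    vertex′ (suc i) = vertex w i
    inside′ : ∀ i → i ≤ _ → δ _ (vertex′ i)
    inside′ zero _ = x∈δz
    inside′ (suc i) (s≤s i≤t) = inside w i i≤t
    step′ : ∀ i → i < _ → vertex′ i ⇝ vertex′ (suc i)
    step′ zero _ = x⇝w₀
    step′ (suc i) (s≤s i<t) = step w i i<t

  -- Read backwards from b, the closed walk a → ⋯ → b = a is a forbidden cycle.
  walk-repeat⇒⊥ : ∀ {z t} → 1 ≤ dim z → (w : Walk z t) → ∀ {a b} → a < b → b ≤ t →
    vertex w a ≡ vertex w b → ⊥
  walk-repeat⇒⊥ {z} {t} q w {a} {b} a<b b≤t va≡vb = acyclic z q p ys ys∈δz edges closing
    where
    p = b ∸ suc a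
    ys : Fin (suc p) → Fin N
    ys m = vertex w (b ∸ toℕ m)
    ys∈δz : ∀ m → δ z (ys m)
    ys∈δz m = inside w _ (≤-trans (m∸n≤m b (toℕ m)) b≤t)
    descend : ∀ i → i < b → vertex w (b ∸ suc i) ⇝ vertex w (b ∸ i)
    descend i i<b = subst (λ j → vertex w (b ∸ suc i) ⇝ vertex w j) next (step w _ bound)
      where
      next : suc (b ∸ suc i) ≡ b ∸ i
      next = sym (+-∸-assoc 1 i<b)
      bound : b ∸ suc i < t
      bound = ≤-trans (≤-reflexive next) (≤-trans (m∸n≤m b i) b≤t)
    edges : ∀ (m : Fin p) → ys (F.suc m) ⇝ ys (inject₁ m)
    edges m = subst (λ i → vertex w (b ∸ suc (toℕ m)) ⇝ vertex w (b ∸ i)) (sym (toℕ-inject₁ m))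
      (descend (toℕ m) (<-≤-trans (toℕ<n m) (m∸n≤m b (suc a))))
    closing : ys F.zero ⇝ ys (fromℕ p)
    closing = subst₂ (λ u j → u ⇝ vertex w j) va≡vb end (step w a (<-≤-trans a<b b≤t))
      where
      end : suc a ≡ b ∸ toℕ (fromℕ p)
      end = sym (trans (cong (b ∸_) (toℕ-fromℕ p)) (m∸[m∸n]≡n a<b))

  ¬Walk-of-length-N : ∀ {z} → 1 ≤ dim z → ¬ Walk z N
  ¬Walk-of-length-N q w with pigeonhole (n<1+n N) (λ i → vertex w (toℕ i))
  ... | i , j , i<j , vi≡vj = walk-repeat⇒⊥ q w i<j (toℕ≤pred[n] j) vi≡vj

  module _ {z} (Q : Fin N → Set) {G : Set}
           (progress : ∀ {x} → δ z x → Q x → G ⊎ ∃[ x' ] (δ z x' × Q x' × x ⇝ x')) where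

    walk-or-escape : ∀ t {x} → δ z x → Q x → G ⊎ Σ (Walk z t) (λ w → vertex w 0 ≡ x)
    walk-or-escape zero {x} x∈δz _ =
      inj₂ (record { vertex = λ _ → x ; inside = λ _ _ → x∈δz ; step = λ _ () } , refl)
    walk-or-escape (suc t) x∈δz Qx with progress x∈δz Qx
    ... | inj₁ g = inj₁ g
    ... | inj₂ (x' , x'∈δz , Qx' , x⇝x') with walk-or-escape t x'∈δz Qx'
    ...   | inj₁ g = inj₁ g
    ...   | inj₂ (w , refl) = inj₂ (cons x∈δz w x⇝x' , refl)

    ⇝-escape : ∀ {x} → δ z x → Q x → G
    ⇝-escape x∈δz Qx with walk-or-escape N x∈δz Qx
    ... | inj₁ g = g
    ... | inj₂ (w , _) = contradiction w (¬Walk-of-length-N q)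
      where
      q : 1 ≤ dim z
      q = subst (1 ≤_) (sym (rel-dim _ _ _ x∈δz)) (s≤s z≤n)

  ≼γ-from-δ : ∀ {y z x₀} → (∀ {x} → δ z x → y ≼ x → y ≼γ x) → δ z x₀ → y ≼ x₀ → y ≼γ z
  ≼γ-from-δ {y} {z} below-γ = ⇝-escape (y ≼_) progress
    where
    progress : ∀ {x} → δ z x → y ≼ x → y ≼γ z ⊎ ∃[ x' ] (δ z x' × y ≼ x' × x ⇝ x')
    progress x∈δz y≼x with below-γ x∈δz y≼x
    ... | w , w≺⁺x , y≼w with thin-signs w≺⁺x x∈δz
    ... | x' , S.+ , S.+ , w≺⁺x' , x'≺⁺z , _ = inj₁ (x' , x'≺⁺z , y≼w ▹ inj₂ w≺⁺x')
    ... | x' , S.- , S.- , w≺⁻x' , x'≺⁻z , _ = inj₂ (x' , x'≺⁻z , y≼w ▹ inj₁ w≺⁻x' , w , w≺⁺x , w≺⁻x')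
    ... | _ , S.+ , S.- , _ , _ , ()
    ... | _ , S.- , S.+ , _ , _ , ()

  module _ {k y} (y∈Λ : Λ k y) where

    Λ-δ-δ⇒≼γ : ∀ {x z} → δ x y → δ z x → y ≼γ z
    Λ-δ-δ⇒≼γ y≺⁻x x≺⁻z with thin-signs y≺⁻x x≺⁻z
    ... | x' , S.+ , S.- , y≺⁻x' , x'≺⁺z , _ = x' , x'≺⁺z , inj₁ y≺⁻x' ◅ ε
    ... | _ , S.- , S.+ , y≺⁺x' , _ , _ = contradiction y≺⁺x' (Λ-¬≺⁺ y∈Λ)
    ... | _ , S.+ , S.+ , _ , _ , ()
    ... | _ , S.- , S.- , _ , _ , ()

    Λ-≼γ : ∀ d {z} → dim z ≡ suc d + suc k → y ≼ z → y ≼γ z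
    Λ-≼γ d {z} e y≼z with ≼-penultimate y≼z dim-y<dim-z
      where
      dim-y<dim-z : dim y < dim z
      dim-y<dim-z = subst₂ _<_ (sym (proj₁ y∈Λ)) (sym e) (m≤n+m (suc k) (suc d))
    ... | x , y≼x , inj₂ x≺⁺z = x , x≺⁺z , y≼x
    Λ-≼γ zero e y≼z | x , y≼x , inj₁ x≺⁻z =
      Λ-δ-δ⇒≼γ (Λ-≺⇒δ y∈Λ (≼-covering⇒≺ y≼x dim-x)) x≺⁻z
      where
      dim-x : dim x ≡ suc (dim y)
      dim-x = trans (δ-dim x≺⁻z e) (cong suc (sym (proj₁ y∈Λ)))
    Λ-≼γ (suc d) e y≼z | x , y≼x , inj₁ x≺⁻z =
      ≼γ-from-δ (λ x'≺⁻z → Λ-≼γ d (δ-dim x'≺⁻z e)) x≺⁻z y≼x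

    Λ-≼-γ^ : ∀ j z (p : j ≤ dim z) → dim z ≡ j + suc k → y ≼ z → y ≼ γ^ j z p
    Λ-≼-γ^ zero z p e y≼z = y≼z
    Λ-≼-γ^ (suc j) z p e y≼z =
      Λ-≼-γ^ j _ _ (suc-injective (trans (sym (γ-dim z _)) e)) (≼γ⇒≼-γ (Λ-≼γ j e y≼z) _)

    Λ-≼-γ⁽⁾ : ∀ {x} → suc k ≤ dim x → y ≼ x → y ≼ γ⁽ suc k ⁾ x
    Λ-≼-γ⁽⁾ {x} k<dim = Λ-≼-γ^ (dim x ∸ suc k) x _ (sym (m∸n+n≡m k<dim))

mainTheorem18 : ∀ {N : ℕ} (P : POP N) (D : IsDendritic P) →
    ∀ (k : ℕ) → k < POP.dim P (IsDendritic.ω D) →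
    ∀ (y : Fin N) → POP.Λ P k y →
    POP.δ P (POP.γ⁽_⁾ P (suc k) (IsDendritic.ω D)) y
mainTheorem18 P D k k<n y y∈Λ = Λ-≺⇒δ y∈Λ (≼-covering⇒≺ y≼w dim-w)
  where
  open POP P
  open IsDendritic D
  open POPProperties P
  open DendriticProperties D
  y≼w : y ≼ γ⁽ suc k ⁾ ω
  y≼w = Λ-≼-γ⁽⁾ y∈Λ k<n (ω-greatest y)
  dim-w : dim (γ⁽ suc k ⁾ ω) ≡ suc (dim y)
  dim-w = trans (γ⁽⁾-dim k<n) (cong suc (sym (proj₁ y∈Λ)))
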